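{- Let $p$ be an odd prime. Then $$\sum_{k=0}^{[\frac{p-1}8]}\frac{\binom{8k}{4k}}{4^{4k-1}}\equiv\begin{cases}1+(-1)^{\frac{p-1}8}2^{\frac{p+3}4}\pmod p&\text{if }p\equiv1\pmod8,\\ -1+(-1)^{\frac{p-3}8}2^{\frac{p+1}4}\pmod p&\text{if }p\equiv3\pmod8,\\ -1\pmod p&\text{if }p\equiv5\pmod8,\\ 1-(-1)^{\frac{p-7}8}2^{\frac{p+1}4}\pmod p&\text{if }p\equiv7\pmod8.\end{cases}$$
   Context: $[x]$ is the greatest integer not exceeding $x$. -}

module Defs where

open import Data.Nat as ℕ using (ℕ; zero; suc)
open import Data.Nat.Properties using (m^n≢0)
open import Data.Nat.Combinatorics using (_C_)
open import Data.Integer as ℤ using (ℤ; +_)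
open import Data.Integer.Divisibility using () renaming (_∣_ to _∣ℤ_)
open import Data.Rational as ℚ using (ℚ; ↥_)

-- The k-th summand  C(8k,4k) / 4^(4k-1)  =  4 * C(8k,4k) / 4^(4k)  (exact, also for k = 0).
term : ℕ → ℚ
term k = (+ (4 ℕ.* ((8 ℕ.* k) C (4 ℕ.* k)))) ℚ./ (4 ℕ.^ (4 ℕ.* k))
  where instance _ = m^n≢0 4 (4 ℕ.* k)

sumTo : ℕ → ℚ
sumTo zero = term 0
sumTo (suc n) = sumTo n ℚ.+ term (suc n)

neg1^ : ℕ → ℤ
neg1^ n = (ℤ.- ℤ.1ℤ) ℤ.^ n

_≡_[mod_] : ℚ → ℚ → ℕ → Set
x ≡ y [mod p ] = (+ p) ∣ℤ (↥ (x ℚ.- y))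

-- Write p = 2m + 1.  The proof combines three facts.
--  1. C(2n,n) ≡ (−4)^n·C(m,n) (mod p) for n ≤ m, comparing the ratios of consecutive terms
--     (central≋).  So the k-th summand 4·C(8k,4k)/4^{4k} is ≡ 4·C(m,4k) and the whole sum
--     is ≡ 4·Σ_k C(m,4k) (sumTo-residue); rationals are handled through representations
--     x = a/d with p ∤ d (Residue), which is all the congruence of the statement needs.
--  2. The roots-of-unity filter 4·Σ_k C(M,4k) = 2^M + 2·Re (1+i)^M, proved for the four
--     residue classes mod 4 simultaneously by Pascal's rule (classSumFormulas), together
--     with Re (1+i)^{4t+s} = (−4)^t·Re (1+i)^s (re-period).
--  3. Gauss's evaluation 2^m ≡ (−1)^⌈m/2⌉ (mod p): 2^m·m! = 2·4·…·(2m), and modulo p each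
--     even factor above m is minus an odd factor below m (two^m≋).

module Submission where

open import Defs
open import Data.Nat as ℕ using (ℕ; zero; suc; _≤_; _<_; s≤s; z≤n; _!; _^_; _∸_)
import Data.Nat.Properties as ℕP
open import Data.Nat.DivMod using (_/_; _%_; m*n/n≡m; m<n⇒m/n≡0; +-distrib-/-∣ʳ; m≡m%n+[m/n]*n)
open import Data.Nat.Divisibility as ℕ∣ using () renaming (_∣_ to _∣ℕ_)
open import Data.Nat.Primality using (Prime; euclidsLemma; prime⇒nonTrivial)
open import Data.Nat.Combinatorics using (_C_; k>n⇒nCk≡0; nC1≡n; nCk≡nC[n∸k]; nCk+nC[k+1]≡[n+1]C[k+1])
import Data.Nat.Tactic.RingSolver as ℕSolver
open import Data.Integer as ℤ using (ℤ; +_; _+_; _-_; -_)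
import Data.Integer.Properties as ℤP
import Data.Integer.GCD as ℤGCD
open import Data.Integer.Divisibility.Signed
  using (_∣_; divides; ∣m∣n⇒∣m+n; ∣m⇒∣-m; ∣m⇒∣m*n; ∣n⇒∣m*n; ∣⇒∣ᵤ; ∣ᵤ⇒∣)
open import Data.Integer.Tactic.RingSolver using (solve-∀)
open import Data.Rational as ℚ using (ℚ; mkℚ; ↥_; ↧_)
import Data.Rational.Properties as ℚP
import Data.Rational.Unnormalised as ℚᵘ
open import Data.Product using (_×_; _,_)
open import Data.Sum using (inj₁; inj₂)
open import Relation.Nullary using (¬_; contradiction)
open import Relation.Binary.PropositionalEquality
open import Relation.Binary.Bundles using (Setoid)
import Relation.Binary.Reasoning.Setoid as SetoidReasoning

absorption : ∀ n k → suc k ℕ.* (suc n C suc k) ≡ suc n ℕ.* (n C k)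
absorption zero zero = refl
absorption zero (suc k) rewrite k>n⇒nCk≡0 {0} {suc k} (s≤s z≤n) | ℕP.*-zeroʳ k = refl
absorption (suc n) zero rewrite ℕP.+-identityʳ (suc (suc n) C 1) | nC1≡n (suc (suc n)) =
  sym (ℕP.*-identityʳ (suc (suc n)))
absorption (suc n) (suc k) = begin
  suc (suc k) ℕ.* (suc (suc n) C suc (suc k))
    ≡⟨ cong (suc (suc k) ℕ.*_) (sym (nCk+nC[k+1]≡[n+1]C[k+1] (suc n) (suc k))) ⟩
  suc (suc k) ℕ.* (suc n C suc k ℕ.+ suc n C suc (suc k))
    ≡⟨ distrib (suc n C suc k) (suc n C suc (suc k)) ⟩
  suc n C suc k ℕ.+ (suc k ℕ.* (suc n C suc k) ℕ.+ suc (suc k) ℕ.* (suc n C suc (suc k)))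
    ≡⟨ cong₂ (λ a b → suc n C suc k ℕ.+ (a ℕ.+ b)) (absorption n k) (absorption n (suc k)) ⟩
  suc n C suc k ℕ.+ (suc n ℕ.* (n C k) ℕ.+ suc n ℕ.* (n C suc k))
    ≡⟨ cong (suc n C suc k ℕ.+_) (sym (ℕP.*-distribˡ-+ (suc n) (n C k) (n C suc k))) ⟩
  suc n C suc k ℕ.+ suc n ℕ.* (n C k ℕ.+ n C suc k)
    ≡⟨ cong (λ a → suc n C suc k ℕ.+ suc n ℕ.* a) (nCk+nC[k+1]≡[n+1]C[k+1] n k) ⟩
  suc (suc n) ℕ.* (suc n C suc k) ∎
  where
  open ≡-Reasoning
  distrib : ∀ a b → suc (suc k) ℕ.* (a ℕ.+ b) ≡ a ℕ.+ (suc k ℕ.* a ℕ.+ suc (suc k) ℕ.* b)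
  distrib = ℕSolver.solve-∀

row-ratio : ∀ m k → suc k ℕ.* (m C suc k) ℕ.+ suc k ℕ.* (m C k) ≡ suc m ℕ.* (m C k)
row-ratio m k = begin
  suc k ℕ.* (m C suc k) ℕ.+ suc k ℕ.* (m C k) ≡⟨ sym (ℕP.*-distribˡ-+ (suc k) (m C suc k) (m C k)) ⟩
  suc k ℕ.* (m C suc k ℕ.+ m C k)              ≡⟨ cong (suc k ℕ.*_) (ℕP.+-comm (m C suc k) (m C k)) ⟩
  suc k ℕ.* (m C k ℕ.+ m C suc k)              ≡⟨ cong (suc k ℕ.*_) (nCk+nC[k+1]≡[n+1]C[k+1] m k) ⟩
  suc k ℕ.* (suc m C suc k)                    ≡⟨ absorption m k ⟩
  suc m ℕ.* (m C k)                            ∎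
  where open ≡-Reasoning

central-ratio : ∀ n → suc n ℕ.* ((suc n ℕ.+ suc n) C suc n) ≡ 2 ℕ.* suc (n ℕ.+ n) ℕ.* ((n ℕ.+ n) C n)
central-ratio n = ℕP.*-cancelˡ-≡ _ _ (suc n) (begin
  suc n ℕ.* (suc n ℕ.* ((suc n ℕ.+ suc n) C suc n))
    ≡⟨ cong (λ a → suc n ℕ.* (suc n ℕ.* (a C suc n))) (ℕP.+-suc (suc n) n) ⟩
  suc n ℕ.* (suc n ℕ.* (suc (suc n ℕ.+ n) C suc n))
    ≡⟨ cong (suc n ℕ.*_) (absorption (suc n ℕ.+ n) n) ⟩
  suc n ℕ.* (suc (suc n ℕ.+ n) ℕ.* ((suc n ℕ.+ n) C n))
    ≡⟨ cong (λ a → suc n ℕ.* (suc (suc n ℕ.+ n) ℕ.* a)) symmetry ⟩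
  suc n ℕ.* (suc (suc n ℕ.+ n) ℕ.* ((suc n ℕ.+ n) C suc n))
    ≡⟨ swap (suc n) (suc (suc n ℕ.+ n)) ((suc n ℕ.+ n) C suc n) ⟩
  suc (suc n ℕ.+ n) ℕ.* (suc n ℕ.* ((suc n ℕ.+ n) C suc n))
    ≡⟨ cong (suc (suc n ℕ.+ n) ℕ.*_) (absorption (n ℕ.+ n) n) ⟩
  suc (suc n ℕ.+ n) ℕ.* (suc (n ℕ.+ n) ℕ.* ((n ℕ.+ n) C n))
    ≡⟨ regroup n ((n ℕ.+ n) C n) ⟩
  suc n ℕ.* (2 ℕ.* suc (n ℕ.+ n) ℕ.* ((n ℕ.+ n) C n)) ∎)
  where
  open ≡-Reasoning
  symmetry : (suc n ℕ.+ n) C n ≡ (suc n ℕ.+ n) C suc n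
  symmetry = trans (nCk≡nC[n∸k] (ℕP.m≤n+m n (suc n))) (cong ((suc n ℕ.+ n) C_) (ℕP.m+n∸n≡m (suc n) n))
  swap : ∀ a b c → a ℕ.* (b ℕ.* c) ≡ b ℕ.* (a ℕ.* c)
  swap = ℕSolver.solve-∀
  regroup : ∀ n x → suc (suc n ℕ.+ n) ℕ.* (suc (n ℕ.+ n) ℕ.* x) ≡ suc n ℕ.* (2 ℕ.* suc (n ℕ.+ n) ℕ.* x)
  regroup = ℕSolver.solve-∀

cast-+ : ∀ {a b c d} → a ℕ.+ b ≡ c ℕ.+ d → + a + + b ≡ + c + + d
cast-+ {a} {b} {c} {d} e = trans (sym (ℤP.pos-+ a b)) (trans (cong +_ e) (ℤP.pos-+ c d))

cast-* : ∀ {a b c d} → a ℕ.* b ≡ c ℕ.* d → + a ℤ.* + b ≡ + c ℤ.* + d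
cast-* {a} {b} {c} {d} e = trans (sym (ℤP.pos-* a b)) (trans (cong +_ e) (ℤP.pos-* c d))

pos-^ : ∀ a n → + (a ^ n) ≡ (+ a) ℤ.^ n
pos-^ a zero    = refl
pos-^ a (suc n) = trans (ℤP.pos-* a (a ^ n)) (cong (+ a ℤ.*_) (pos-^ a n))

neg^-even : ∀ x j → (- x) ℤ.^ (2 ℕ.* j) ≡ x ℤ.^ (2 ℕ.* j)
neg^-even x j = begin
  (- x) ℤ.^ (2 ℕ.* j)       ≡⟨ ℤP.^-*-assoc (- x) 2 j ⟨
  ((- x) ℤ.^ 2) ℤ.^ j       ≡⟨ cong (ℤ._^ j) (square x) ⟩
  (x ℤ.^ 2) ℤ.^ j           ≡⟨ ℤP.^-*-assoc x 2 j ⟩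
  x ℤ.^ (2 ℕ.* j)           ∎
  where
  open ≡-Reasoning
  square : ∀ x → (- x) ℤ.* ((- x) ℤ.* + 1) ≡ x ℤ.* (x ℤ.* + 1)
  square = solve-∀

neg1^-even : ∀ j → neg1^ (2 ℕ.* j) ≡ + 1
neg1^-even j = trans (neg^-even (+ 1) j) (ℤP.^-zeroˡ (2 ℕ.* j))

minus4^ : ∀ t → (- + 4) ℤ.^ t ≡ neg1^ t ℤ.* (+ 2) ℤ.^ (2 ℕ.* t)
minus4^ zero    = refl
minus4^ (suc t) = begin
  - + 4 ℤ.* (- + 4) ℤ.^ t                              ≡⟨ cong (- + 4 ℤ.*_) (minus4^ t) ⟩
  - + 4 ℤ.* (neg1^ t ℤ.* (+ 2) ℤ.^ (2 ℕ.* t))           ≡⟨ ring (neg1^ t) ((+ 2) ℤ.^ (2 ℕ.* t)) ⟩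
  neg1^ (suc t) ℤ.* (+ 2) ℤ.^ (2 ℕ.+ 2 ℕ.* t)           ≡⟨ cong (λ e → neg1^ (suc t) ℤ.* (+ 2) ℤ.^ e) (ℕP.*-suc 2 t) ⟨
  neg1^ (suc t) ℤ.* (+ 2) ℤ.^ (2 ℕ.* suc t)             ∎
  where
  open ≡-Reasoning
  ring : ∀ s w → - + 4 ℤ.* (s ℤ.* w) ≡ (- + 1 ℤ.* s) ℤ.* (+ 2 ℤ.* (+ 2 ℤ.* w))
  ring = solve-∀

-- (−4)^t · 2^k = (−1)^t · 2^{2t+k}: the shape of the powers in the statement.
minus4^*two^ : ∀ t k → (- + 4) ℤ.^ t ℤ.* (+ 2) ℤ.^ k ≡ neg1^ t ℤ.* + (2 ^ (2 ℕ.* t ℕ.+ k))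
minus4^*two^ t k = begin
  (- + 4) ℤ.^ t ℤ.* (+ 2) ℤ.^ k                       ≡⟨ cong (ℤ._* (+ 2) ℤ.^ k) (minus4^ t) ⟩
  neg1^ t ℤ.* (+ 2) ℤ.^ (2 ℕ.* t) ℤ.* (+ 2) ℤ.^ k     ≡⟨ ℤP.*-assoc (neg1^ t) _ _ ⟩
  neg1^ t ℤ.* ((+ 2) ℤ.^ (2 ℕ.* t) ℤ.* (+ 2) ℤ.^ k)   ≡⟨ cong (neg1^ t ℤ.*_) (ℤP.^-distribˡ-+-* (+ 2) (2 ℕ.* t) k) ⟨
  neg1^ t ℤ.* (+ 2) ℤ.^ (2 ℕ.* t ℕ.+ k)               ≡⟨ cong (neg1^ t ℤ.*_) (pos-^ 2 (2 ℕ.* t ℕ.+ k)) ⟨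
  neg1^ t ℤ.* + (2 ^ (2 ℕ.* t ℕ.+ k))                 ∎
  where open ≡-Reasoning

cast-difference : ∀ {a b c} → a ℕ.+ b ≡ c → + a ≡ + c - + b
cast-difference {a} {b} {c} e = begin
  + a                  ≡⟨ ring (+ a) (+ b) ⟩
  (+ a + + b) - + b    ≡⟨ cong (_- + b) (ℤP.pos-+ a b) ⟨
  + (a ℕ.+ b) - + b    ≡⟨ cong (λ x → + x - + b) e ⟩
  + c - + b            ∎
  where
  open ≡-Reasoning
  ring : ∀ x y → x ≡ (x + y) - y
  ring = solve-∀

row-ratioℤ : ∀ m k → + suc k ℤ.* + (m C suc k) ≡ (+ suc m - + suc k) ℤ.* + (m C k)
row-ratioℤ m k = begin
  + suc k ℤ.* + (m C suc k)                           ≡⟨ ℤP.pos-* (suc k) (m C suc k) ⟨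
  + (suc k ℕ.* (m C suc k))                           ≡⟨ cast-difference {suc k ℕ.* (m C suc k)} (row-ratio m k) ⟩
  + (suc m ℕ.* (m C k)) - + (suc k ℕ.* (m C k))       ≡⟨ cong₂ _-_ (ℤP.pos-* (suc m) (m C k)) (ℤP.pos-* (suc k) (m C k)) ⟩
  + suc m ℤ.* + (m C k) - + suc k ℤ.* + (m C k)       ≡⟨ ring (+ suc m) (+ suc k) (+ (m C k)) ⟩
  (+ suc m - + suc k) ℤ.* + (m C k)                   ∎
  where
  open ≡-Reasoning
  ring : ∀ M N v → M ℤ.* v - N ℤ.* v ≡ (M - N) ℤ.* v
  ring = solve-∀

-- 2(2n+1) + 4(m-n) = 2(2m+1): the two ratios of central≋ below differ by twice the prime.
central-factor : ∀ n m → + (2 ℕ.* suc (n ℕ.+ n)) - - + 4 ℤ.* (+ suc m - + suc n) ≡ + 2 ℤ.* + suc (2 ℕ.* m)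
central-factor n m = begin
  X - - + 4 ℤ.* (M - N)                       ≡⟨ ring X M N ⟩
  (X + + 4 ℤ.* M) - + 4 ℤ.* N                 ≡⟨ cong (λ z → (X + z) - + 4 ℤ.* N) (ℤP.pos-* 4 (suc m)) ⟨
  (X + + (4 ℕ.* suc m)) - + 4 ℤ.* N
      ≡⟨ cong (_- + 4 ℤ.* N) (cast-+ {2 ℕ.* suc (n ℕ.+ n)} {4 ℕ.* suc m} {4 ℕ.* suc n} {2 ℕ.* P} (identity n m)) ⟩
  (+ (4 ℕ.* suc n) + + (2 ℕ.* P)) - + 4 ℤ.* N
      ≡⟨ cong₂ (λ a b → (a + b) - + 4 ℤ.* N) (ℤP.pos-* 4 (suc n)) (ℤP.pos-* 2 P) ⟩
  (+ 4 ℤ.* N + + 2 ℤ.* + P) - + 4 ℤ.* N       ≡⟨ ring′ (+ 4 ℤ.* N) (+ 2 ℤ.* + P) ⟩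
  + 2 ℤ.* + P                                 ∎
  where
  open ≡-Reasoning
  X = + (2 ℕ.* suc (n ℕ.+ n))
  M = + suc m
  N = + suc n
  P = suc (2 ℕ.* m)
  identity : ∀ n m → 2 ℕ.* suc (n ℕ.+ n) ℕ.+ 4 ℕ.* suc m ≡ 4 ℕ.* suc n ℕ.+ 2 ℕ.* suc (2 ℕ.* m)
  identity = ℕSolver.solve-∀
  ring : ∀ x M N → x - - + 4 ℤ.* (M - N) ≡ (x + + 4 ℤ.* M) - + 4 ℤ.* N
  ring = solve-∀
  ring′ : ∀ a b → (a + b) - a ≡ b
  ring′ = solve-∀

even+odd : ∀ h c → + (2 ℕ.* suc h) - - + suc (2 ℕ.* c) ≡ + 1 ℤ.* + suc (2 ℕ.* (h ℕ.+ suc c))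
even+odd h c = begin
  + a - - + b      ≡⟨ ring (+ a) (+ b) ⟩
  + a + + b        ≡⟨ ℤP.pos-+ a b ⟨
  + (a ℕ.+ b)      ≡⟨ cong +_ (sum h c) ⟩
  + P              ≡⟨ ℤP.*-identityˡ (+ P) ⟨
  + 1 ℤ.* + P      ∎
  where
  open ≡-Reasoning
  a = 2 ℕ.* suc h
  b = suc (2 ℕ.* c)
  P = suc (2 ℕ.* (h ℕ.+ suc c))
  ring : ∀ x y → x - - y ≡ x + y
  ring = solve-∀
  sum : ∀ h c → 2 ℕ.* suc h ℕ.+ suc (2 ℕ.* c) ≡ suc (2 ℕ.* (h ℕ.+ suc c))
  sum = ℕSolver.solve-∀

classSum : ℕ → ℕ → ℕ → ℕ
classSum r zero    M = M C r
classSum r (suc B) M = classSum r B M ℕ.+ M C (r ℕ.+ 4 ℕ.* suc B)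

classSum-pascal : ∀ r B M → classSum (suc r) B (suc M) ≡ classSum (suc r) B M ℕ.+ classSum r B M
classSum-pascal r zero M =
  trans (sym (nCk+nC[k+1]≡[n+1]C[k+1] M r)) (ℕP.+-comm (M C r) (M C suc r))
classSum-pascal r (suc B) M = begin
  classSum (suc r) B (suc M) ℕ.+ suc M C suc j
    ≡⟨ cong₂ ℕ._+_ (classSum-pascal r B M) (sym (nCk+nC[k+1]≡[n+1]C[k+1] M j)) ⟩
  (classSum (suc r) B M ℕ.+ classSum r B M) ℕ.+ (M C j ℕ.+ M C suc j)
    ≡⟨ shuffle (classSum (suc r) B M) (classSum r B M) (M C j) (M C suc j) ⟩
  (classSum (suc r) B M ℕ.+ M C suc j) ℕ.+ (classSum r B M ℕ.+ M C j) ∎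
  where
  open ≡-Reasoning
  j = r ℕ.+ 4 ℕ.* suc B
  shuffle : ∀ a b c d → (a ℕ.+ b) ℕ.+ (c ℕ.+ d) ≡ (a ℕ.+ d) ℕ.+ (b ℕ.+ c)
  shuffle = ℕSolver.solve-∀

-- For class 0 the index 4(k+1) comes from 4k+3, i.e. from class 3 with k shifted by one;
-- the term C(M, 3 + 4B) accounts for the top of the range.
classSum-pascal₀ : ∀ B M → classSum 0 B (suc M) ℕ.+ M C (3 ℕ.+ 4 ℕ.* B) ≡ classSum 0 B M ℕ.+ classSum 3 B M
classSum-pascal₀ zero M = refl
classSum-pascal₀ (suc B) M = begin
  (S′ ℕ.+ suc M C (4 ℕ.* suc B)) ℕ.+ top
    ≡⟨ cong (λ i → (S′ ℕ.+ suc M C i) ℕ.+ top) (ℕP.*-suc 4 B) ⟩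
  (S′ ℕ.+ suc M C suc j) ℕ.+ top
    ≡⟨ cong (λ x → (S′ ℕ.+ x) ℕ.+ top) (sym (nCk+nC[k+1]≡[n+1]C[k+1] M j)) ⟩
  (S′ ℕ.+ (M C j ℕ.+ M C suc j)) ℕ.+ top
    ≡⟨ regroup S′ (M C j) (M C suc j) top ⟩
  ((S′ ℕ.+ M C j) ℕ.+ M C suc j) ℕ.+ top
    ≡⟨ cong (λ x → (x ℕ.+ M C suc j) ℕ.+ top) (classSum-pascal₀ B M) ⟩
  ((classSum 0 B M ℕ.+ classSum 3 B M) ℕ.+ M C suc j) ℕ.+ top
    ≡⟨ shuffle (classSum 0 B M) (classSum 3 B M) (M C suc j) top ⟩
  (classSum 0 B M ℕ.+ M C suc j) ℕ.+ (classSum 3 B M ℕ.+ top)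
    ≡⟨ cong (λ i → (classSum 0 B M ℕ.+ M C i) ℕ.+ classSum 3 (suc B) M) (ℕP.*-suc 4 B) ⟨
  classSum 0 (suc B) M ℕ.+ classSum 3 (suc B) M ∎
  where
  open ≡-Reasoning
  S′ = classSum 0 B (suc M)
  j = 3 ℕ.+ 4 ℕ.* B
  top = M C (3 ℕ.+ 4 ℕ.* suc B)
  regroup : ∀ a b c d → (a ℕ.+ (b ℕ.+ c)) ℕ.+ d ≡ ((a ℕ.+ b) ℕ.+ c) ℕ.+ d
  regroup = ℕSolver.solve-∀
  shuffle : ∀ a b c d → ((a ℕ.+ b) ℕ.+ c) ℕ.+ d ≡ (a ℕ.+ c) ℕ.+ (b ℕ.+ d)
  shuffle = ℕSolver.solve-∀

classSum-row1 : ∀ r B → classSum r B 1 ≡ 1 C r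
classSum-row1 r zero = refl
classSum-row1 r (suc B) = begin
  classSum r B 1 ℕ.+ 1 C (r ℕ.+ 4 ℕ.* suc B) ≡⟨ cong₂ ℕ._+_ (classSum-row1 r B) (k>n⇒nCk≡0 1<index) ⟩
  1 C r ℕ.+ 0                                ≡⟨ ℕP.+-identityʳ (1 C r) ⟩
  1 C r                                      ∎
  where
  open ≡-Reasoning
  1<index : 1 < r ℕ.+ 4 ℕ.* suc B
  1<index = subst (λ i → 1 < r ℕ.+ i) (sym (ℕP.*-suc 4 B))
              (ℕP.≤-trans (s≤s (s≤s z≤n)) (ℕP.m≤n+m (4 ℕ.+ 4 ℕ.* B) r))

-- (1 + i)^M = re M + i · im M in the Gaussian integers.
re im : ℕ → ℤ
re zero    = + 1
re (suc M) = re M - im M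
im zero    = + 0
im (suc M) = re M + im M

-- The four class sums of row M ≥ 1 (the roots-of-unity filter with 1, i, -1, -i):
-- 4·Σ_{j ≡ r (4)} C(M,j) = 2^M + 2·Re(i^{-r}(1+i)^M).
record ClassSumFormulas (B M : ℕ) : Set where
  field
    class₀ : + 4 ℤ.* + classSum 0 B M ≡ (+ 2) ℤ.^ M + + 2 ℤ.* re M
    class₁ : + 4 ℤ.* + classSum 1 B M ≡ (+ 2) ℤ.^ M + + 2 ℤ.* im M
    class₂ : + 4 ℤ.* + classSum 2 B M ≡ (+ 2) ℤ.^ M - + 2 ℤ.* re M
    class₃ : + 4 ℤ.* + classSum 3 B M ≡ (+ 2) ℤ.^ M - + 2 ℤ.* im M

-- The formulas hold while all of row M lies in the summation range (M ≤ 3 + 4B):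
-- both sides satisfy Pascal's recurrence and agree on row 1.
classSumFormulas : ∀ B M → suc M ≤ 3 ℕ.+ 4 ℕ.* B → ClassSumFormulas B (suc M)
classSumFormulas B zero _ = record
  { class₀ = cong (λ s → + 4 ℤ.* + s) (classSum-row1 0 B)
  ; class₁ = cong (λ s → + 4 ℤ.* + s) (classSum-row1 1 B)
  ; class₂ = cong (λ s → + 4 ℤ.* + s) (classSum-row1 2 B)
  ; class₃ = cong (λ s → + 4 ℤ.* + s) (classSum-row1 3 B) }
classSumFormulas B (suc M) M′<3+4B = record
  { class₀ = step (classSum 0 B M′) (classSum 3 B M′) pascal₀ class₀ class₃ (ring₀ w a b)
  ; class₁ = step (classSum 1 B M′) (classSum 0 B M′) (classSum-pascal 0 B M′) class₁ class₀ (ring₁ w a b)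
  ; class₂ = step (classSum 2 B M′) (classSum 1 B M′) (classSum-pascal 1 B M′) class₂ class₁ (ring₂ w a b)
  ; class₃ = step (classSum 3 B M′) (classSum 2 B M′) (classSum-pascal 2 B M′) class₃ class₂ (ring₃ w a b) }
  where
  M′ = suc M
  open ClassSumFormulas (classSumFormulas B M (ℕP.≤-trans (ℕP.n≤1+n M′) M′<3+4B))
  w = (+ 2) ℤ.^ M′
  a = re M′
  b = im M′
  -- M′ < 3 + 4B, so the correction term of classSum-pascal₀ vanishes
  pascal₀ : classSum 0 B (suc M′) ≡ classSum 0 B M′ ℕ.+ classSum 3 B M′
  pascal₀ = begin
    classSum 0 B (suc M′)                              ≡⟨ ℕP.+-identityʳ _ ⟨
    classSum 0 B (suc M′) ℕ.+ 0                        ≡⟨ cong (classSum 0 B (suc M′) ℕ.+_) (k>n⇒nCk≡0 M′<3+4B) ⟨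
    classSum 0 B (suc M′) ℕ.+ M′ C (3 ℕ.+ 4 ℕ.* B)     ≡⟨ classSum-pascal₀ B M′ ⟩
    classSum 0 B M′ ℕ.+ classSum 3 B M′                ∎
    where open ≡-Reasoning
  step : ∀ s₁ s₂ {s v₁ v₂ v} → s ≡ s₁ ℕ.+ s₂ → + 4 ℤ.* + s₁ ≡ v₁ → + 4 ℤ.* + s₂ ≡ v₂ → v₁ + v₂ ≡ v →
         + 4 ℤ.* + s ≡ v
  step s₁ s₂ refl e₁ e₂ e = begin
    + 4 ℤ.* + (s₁ ℕ.+ s₂)          ≡⟨ cong (+ 4 ℤ.*_) (ℤP.pos-+ s₁ s₂) ⟩
    + 4 ℤ.* (+ s₁ + + s₂)          ≡⟨ ℤP.*-distribˡ-+ (+ 4) (+ s₁) (+ s₂) ⟩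
    + 4 ℤ.* + s₁ + + 4 ℤ.* + s₂    ≡⟨ cong₂ _+_ e₁ e₂ ⟩
    _                              ≡⟨ e ⟩
    _                              ∎
    where open ≡-Reasoning
  ring₀ : ∀ w a b → (w + + 2 ℤ.* a) + (w - + 2 ℤ.* b) ≡ + 2 ℤ.* w + + 2 ℤ.* (a - b)
  ring₀ = solve-∀
  ring₁ : ∀ w a b → (w + + 2 ℤ.* b) + (w + + 2 ℤ.* a) ≡ + 2 ℤ.* w + + 2 ℤ.* (a + b)
  ring₁ = solve-∀
  ring₂ : ∀ w a b → (w - + 2 ℤ.* a) + (w + + 2 ℤ.* b) ≡ + 2 ℤ.* w - + 2 ℤ.* (a - b)
  ring₂ = solve-∀
  ring₃ : ∀ w a b → (w - + 2 ℤ.* b) + (w - + 2 ℤ.* a) ≡ + 2 ℤ.* w - + 2 ℤ.* (a + b)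
  ring₃ = solve-∀

class₀-formula : ∀ B M → 1 ≤ M → M ≤ 3 ℕ.+ 4 ℕ.* B →
                 + 4 ℤ.* + classSum 0 B M ≡ (+ 2) ℤ.^ M + + 2 ℤ.* re M
class₀-formula B (suc M) _ M≤ = ClassSumFormulas.class₀ (classSumFormulas B M M≤)

-- (1+i)^4 = −4, hence Re (1+i)^{4t+s} = (−4)^t · Re (1+i)^s.
re-shift : ∀ x → re (4 ℕ.+ x) ≡ - + 4 ℤ.* re x
re-shift x = ring (re x) (im x)
  where
  ring : ∀ a b → let a₂ = (a - b) - (a + b) ; b₂ = (a - b) + (a + b) in
                 (a₂ - b₂) - (a₂ + b₂) ≡ - + 4 ℤ.* a
  ring = solve-∀

re-period : ∀ t s → re (t ℕ.* 4 ℕ.+ s) ≡ (- + 4) ℤ.^ t ℤ.* re s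
re-period zero    s = sym (ℤP.*-identityˡ (re s))
re-period (suc t) s = trans (re-shift (t ℕ.* 4 ℕ.+ s))
  (trans (cong (- + 4 ℤ.*_) (re-period t s)) (sym (ℤP.*-assoc (- + 4) ((- + 4) ℤ.^ t) (re s))))

evens : ℕ → ℕ
evens zero    = 1
evens (suc h) = evens h ℕ.* (2 ℕ.* suc h)

odds : ℕ → ℕ
odds zero    = 1
odds (suc c) = odds c ℕ.* suc (2 ℕ.* c)

evensFrom : ℕ → ℕ → ℕ
evensFrom h zero    = 1
evensFrom h (suc c) = 2 ℕ.* suc h ℕ.* evensFrom (suc h) c

evens≡2^h*h! : ∀ h → evens h ≡ 2 ^ h ℕ.* h !
evens≡2^h*h! zero    = refl
evens≡2^h*h! (suc h) = trans (cong (ℕ._* (2 ℕ.* suc h)) (evens≡2^h*h! h)) (ring (2 ^ h) (h !) h)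
  where ring : ∀ a f h → a ℕ.* f ℕ.* (2 ℕ.* suc h) ≡ 2 ℕ.* a ℕ.* (suc h ℕ.* f)
        ring = ℕSolver.solve-∀

evens-split : ∀ h c → evens (h ℕ.+ c) ≡ evens h ℕ.* evensFrom h c
evens-split h zero    = trans (cong evens (ℕP.+-identityʳ h)) (sym (ℕP.*-identityʳ (evens h)))
evens-split h (suc c) = begin
  evens (h ℕ.+ suc c)                                  ≡⟨ cong evens (ℕP.+-suc h c) ⟩
  evens (suc h ℕ.+ c)                                  ≡⟨ evens-split (suc h) c ⟩
  evens h ℕ.* (2 ℕ.* suc h) ℕ.* evensFrom (suc h) c    ≡⟨ ℕP.*-assoc (evens h) (2 ℕ.* suc h) _ ⟩
  evens h ℕ.* evensFrom h (suc c)                      ∎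
  where open ≡-Reasoning

evens*odds : ∀ h → evens h ℕ.* odds h ≡ (h ℕ.+ h) !
evens*odds zero    = refl
evens*odds (suc h) = begin
  evens h ℕ.* (2 ℕ.* suc h) ℕ.* (odds h ℕ.* suc (2 ℕ.* h))   ≡⟨ ring (evens h) (odds h) h ⟩
  suc (suc (h ℕ.+ h)) ℕ.* (suc (h ℕ.+ h) ℕ.* (evens h ℕ.* odds h))
      ≡⟨ cong (λ x → suc (suc (h ℕ.+ h)) ℕ.* (suc (h ℕ.+ h) ℕ.* x)) (evens*odds h) ⟩
  suc (suc (h ℕ.+ h)) !                                     ≡⟨ cong (λ x → suc x !) (ℕP.+-suc h h) ⟨
  (suc h ℕ.+ suc h) !                                       ∎
  where
  open ≡-Reasoning
  ring : ∀ e o h → e ℕ.* (2 ℕ.* suc h) ℕ.* (o ℕ.* suc (2 ℕ.* h))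
                 ≡ suc (suc (h ℕ.+ h)) ℕ.* (suc (h ℕ.+ h) ℕ.* (e ℕ.* o))
  ring = ℕSolver.solve-∀

evens*odds-suc : ∀ h → evens h ℕ.* odds (suc h) ≡ suc (h ℕ.+ h) !
evens*odds-suc h = trans (ring (evens h) (odds h) h) (cong (suc (h ℕ.+ h) ℕ.*_) (evens*odds h))
  where ring : ∀ e o h → e ℕ.* (o ℕ.* suc (2 ℕ.* h)) ≡ suc (h ℕ.+ h) ℕ.* (e ℕ.* o)
        ring = ℕSolver.solve-∀

Represents : ℚ → ℤ → ℕ → Set
Represents x a d = ↥ x ℤ.* + d ≡ a ℤ.* ↧ x

represents-/ : ∀ i n .{{_ : ℕ.NonZero n}} → Represents (i ℚ./ n) i n
represents-/ i n = begin
  ↥ q ℤ.* + n         ≡⟨ cong (↥ q ℤ.*_) (ℚP.↧-/ i n) ⟨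
  ↥ q ℤ.* (↧ q ℤ.* g) ≡⟨ ring (↥ q) (↧ q) g ⟩
  (↥ q ℤ.* g) ℤ.* ↧ q ≡⟨ cong (ℤ._* ↧ q) (ℚP.↥-/ i n) ⟩
  i ℤ.* ↧ q           ∎
  where
  open ≡-Reasoning
  q = i ℚ./ n
  g = ℤGCD.gcd i (+ n)
  ring : ∀ a b c → a ℤ.* (b ℤ.* c) ≡ (a ℤ.* c) ℤ.* b
  ring = solve-∀

represents-neg : ∀ {x a d} → Represents x a d → Represents (ℚ.- x) (- a) d
represents-neg {x} {a} {d} r = begin
  ↥ (ℚ.- x) ℤ.* + d ≡⟨ cong (ℤ._* + d) (ℚP.↥-neg x) ⟩
  (- ↥ x) ℤ.* + d   ≡⟨ ℤP.neg-distribˡ-* (↥ x) (+ d) ⟨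
  - (↥ x ℤ.* + d)   ≡⟨ cong -_ r ⟩
  - (a ℤ.* ↧ x)     ≡⟨ ℤP.neg-distribˡ-* a (↧ x) ⟩
  (- a) ℤ.* ↧ x     ≡⟨ cong ((- a) ℤ.*_) (ℚP.↧-neg x) ⟨
  (- a) ℤ.* ↧ (ℚ.- x) ∎
  where open ≡-Reasoning

represents-+ : ∀ {x y a b d e} → Represents x a d → Represents y b e →
               Represents (x ℚ.+ y) (a ℤ.* + e + b ℤ.* + d) (d ℕ.* e)
represents-+ {x@(mkℚ _ _ _)} {y@(mkℚ _ _ _)} {a} {b} {d} {e} rx ry = ℤP.*-cancelʳ-≡ _ _ (↧ x ℤ.* ↧ y) (begin
  ↥ s ℤ.* + (d ℕ.* e) ℤ.* (↧ x ℤ.* ↧ y)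
    ≡⟨ cong (λ z → ↥ s ℤ.* z ℤ.* (↧ x ℤ.* ↧ y)) (ℤP.pos-* d e) ⟩
  ↥ s ℤ.* (+ d ℤ.* + e) ℤ.* (↧ x ℤ.* ↧ y)
    ≡⟨ ring₁ (↥ s) (+ d) (+ e) (↧ x ℤ.* ↧ y) ⟩
  (↥ s ℤ.* (↧ x ℤ.* ↧ y)) ℤ.* (+ d ℤ.* + e)
    ≡⟨ cong (ℤ._* (+ d ℤ.* + e)) sum-equation ⟩
  (↥ x ℤ.* ↧ y + ↥ y ℤ.* ↧ x) ℤ.* ↧ s ℤ.* (+ d ℤ.* + e)
    ≡⟨ ring₂ (↥ x) (↧ y) (↥ y) (↧ x) (↧ s) (+ d) (+ e) ⟩
  ↧ s ℤ.* ((↥ x ℤ.* + d) ℤ.* ↧ y ℤ.* + e + (↥ y ℤ.* + e) ℤ.* ↧ x ℤ.* + d)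
    ≡⟨ cong₂ (λ u v → ↧ s ℤ.* (u ℤ.* ↧ y ℤ.* + e + v ℤ.* ↧ x ℤ.* + d)) rx ry ⟩
  ↧ s ℤ.* ((a ℤ.* ↧ x) ℤ.* ↧ y ℤ.* + e + (b ℤ.* ↧ y) ℤ.* ↧ x ℤ.* + d)
    ≡⟨ ring₃ (↧ s) a (↧ x) (↧ y) (+ e) b (+ d) ⟩
  (a ℤ.* + e + b ℤ.* + d) ℤ.* ↧ s ℤ.* (↧ x ℤ.* ↧ y) ∎)
  where
  open ≡-Reasoning
  s = x ℚ.+ y
  -- the defining property of rational addition, read off from the unnormalised sum
  sum-equation : ↥ s ℤ.* (↧ x ℤ.* ↧ y) ≡ (↥ x ℤ.* ↧ y + ↥ y ℤ.* ↧ x) ℤ.* ↧ s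
  sum-equation with ℚP.toℚᵘ-homo-+ x y
  ... | ℚᵘ.*≡* eq = trans (cong (ℤ._* (↧ x ℤ.* ↧ y)) (sym (ℚP.↥ᵘ-toℚᵘ s)))
                      (trans eq (cong ((↥ x ℤ.* ↧ y + ↥ y ℤ.* ↧ x) ℤ.*_) (ℚP.↧ᵘ-toℚᵘ s)))
  ring₁ : ∀ a b c k → a ℤ.* (b ℤ.* c) ℤ.* k ≡ (a ℤ.* k) ℤ.* (b ℤ.* c)
  ring₁ = solve-∀
  ring₂ : ∀ a b c d s D E → (a ℤ.* b + c ℤ.* d) ℤ.* s ℤ.* (D ℤ.* E)
                           ≡ s ℤ.* ((a ℤ.* D) ℤ.* b ℤ.* E + (c ℤ.* E) ℤ.* d ℤ.* D)
  ring₂ = solve-∀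
  ring₃ : ∀ s a X Y E b D → s ℤ.* ((a ℤ.* X) ℤ.* Y ℤ.* E + (b ℤ.* Y) ℤ.* X ℤ.* D)
                           ≡ (a ℤ.* E + b ℤ.* D) ℤ.* s ℤ.* (X ℤ.* Y)
  ring₃ = solve-∀

-- Congruence of integers modulo p; it is an equivalence compatible with +, * and negation.
-- (A record rather than a synonym for divisibility, so that its indices are inferable.)
module Congruence (p : ℕ) where

  infix 4 _≋_
  record _≋_ (a b : ℤ) : Set where
    constructor by-divisibility
    field p∣difference : + p ∣ (a - b)
  open _≋_ public

  ∣-along : ∀ {x y} → x ≡ y → + p ∣ x → + p ∣ y
  ∣-along refl d = d

  ≋-by-multiple : ∀ {a b} q → a - b ≡ q ℤ.* + p → a ≋ b
  ≋-by-multiple q eq = by-divisibility (divides q eq)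

  ≡⇒≋ : ∀ {a b} → a ≡ b → a ≋ b
  ≡⇒≋ {a} refl = ≋-by-multiple (+ 0) (ℤP.+-inverseʳ a)

  ≋-sym : ∀ {a b} → a ≋ b → b ≋ a
  ≋-sym {a} {b} (by-divisibility d) = by-divisibility (∣-along (ring a b) (∣m⇒∣-m d))
    where ring : ∀ a b → - (a - b) ≡ b - a
          ring = solve-∀

  ≋-trans : ∀ {a b c} → a ≋ b → b ≋ c → a ≋ c
  ≋-trans {a} {b} {c} (by-divisibility d) (by-divisibility e) =
    by-divisibility (∣-along (ring a b c) (∣m∣n⇒∣m+n d e))
    where ring : ∀ a b c → (a - b) + (b - c) ≡ a - c
          ring = solve-∀

  ≋-setoid : Setoid _ _
  ≋-setoid = record
    { Carrier = ℤ ; _≈_ = _≋_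
    ; isEquivalence = record { refl = ≡⇒≋ refl ; sym = ≋-sym ; trans = ≋-trans } }

  module ≋-Reasoning = SetoidReasoning ≋-setoid

  +-cong : ∀ {a b c d} → a ≋ b → c ≋ d → a + c ≋ b + d
  +-cong {a} {b} {c} {d} (by-divisibility e) (by-divisibility f) =
    by-divisibility (∣-along (ring a b c d) (∣m∣n⇒∣m+n e f))
    where ring : ∀ a b c d → (a - b) + (c - d) ≡ (a + c) - (b + d)
          ring = solve-∀

  *-cong : ∀ {a b c d} → a ≋ b → c ≋ d → a ℤ.* c ≋ b ℤ.* d
  *-cong {a} {b} {c} {d} (by-divisibility e) (by-divisibility f) =
    by-divisibility (∣-along (ring a b c d) (∣m∣n⇒∣m+n (∣m⇒∣m*n c e) (∣n⇒∣m*n b f)))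
    where ring : ∀ a b c d → (a - b) ℤ.* c + b ℤ.* (c - d) ≡ a ℤ.* c - b ℤ.* d
          ring = solve-∀

  *-congˡ : ∀ a {b c} → b ≋ c → a ℤ.* b ≋ a ℤ.* c
  *-congˡ a = *-cong (≡⇒≋ (refl {x = a}))

  *-congʳ : ∀ {a b} c → a ≋ b → a ℤ.* c ≋ b ℤ.* c
  *-congʳ c e = *-cong e (≡⇒≋ (refl {x = c}))

  neg-cong : ∀ {a b} → a ≋ b → - a ≋ - b
  neg-cong {a} {b} (by-divisibility d) = by-divisibility (∣-along (ring a b) (∣m⇒∣-m d))
    where ring : ∀ a b → - (a - b) ≡ (- a) - (- b)
          ring = solve-∀

module PrimeModulus {p : ℕ} (p-prime : Prime p) where
  open Congruence p

  1<p : 1 < p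
  1<p = ℕ.nonTrivial⇒n>1 p {{prime⇒nonTrivial p-prime}}

  ∤-* : ∀ {a b} → ¬ p ∣ℕ a → ¬ p ∣ℕ b → ¬ p ∣ℕ a ℕ.* b
  ∤-* {a} {b} p∤a p∤b p∣ab with euclidsLemma a b p-prime p∣ab
  ... | inj₁ p∣a = p∤a p∣a
  ... | inj₂ p∣b = p∤b p∣b

  ∣-cancelˡ : ∀ {d} x → ¬ p ∣ℕ d → + p ∣ (+ d ℤ.* x) → + p ∣ x
  ∣-cancelˡ {d} x p∤d p∣dx
    with euclidsLemma d ℤ.∣ x ∣ p-prime (subst (p ∣ℕ_) (ℤP.abs-* (+ d) x) (∣⇒∣ᵤ p∣dx))
  ... | inj₁ p∣d = contradiction p∣d p∤d
  ... | inj₂ p∣x = ∣ᵤ⇒∣ p∣x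

  cancel : ∀ {d a b} → ¬ p ∣ℕ d → + d ℤ.* a ≋ + d ℤ.* b → a ≋ b
  cancel {d} {a} {b} p∤d (by-divisibility e) =
    by-divisibility (∣-cancelˡ (a - b) p∤d (∣-along (ring (+ d) a b) e))
    where ring : ∀ d a b → d ℤ.* a - d ℤ.* b ≡ d ℤ.* (a - b)
          ring = solve-∀

  -- x has residue c modulo p: x = a/d with p ∤ d and a ≡ d·c (mod p).
  -- This is the sense in which a p-integral rational is congruent to an integer.
  record Residue (x : ℚ) (c : ℤ) : Set where
    field
      numer      : ℤ
      denom      : ℕ
      represents : Represents x numer denom
      p∤denom    : ¬ p ∣ℕ denom
      numer≋     : numer ≋ + denom ℤ.* c

  residue-/ : ∀ {c} i n .{{_ : ℕ.NonZero n}} → ¬ p ∣ℕ n → i ≋ + n ℤ.* c → Residue (i ℚ./ n) c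
  residue-/ i n p∤n i≋nc = record
    { numer = i ; denom = n ; represents = represents-/ i n ; p∤denom = p∤n ; numer≋ = i≋nc }

  residue-+ : ∀ {x y c e} → Residue x c → Residue y e → Residue (x ℚ.+ y) (c + e)
  residue-+ {x} {y} {c} {e} rx ry = record
    { numer = numer rx ℤ.* + denom ry + numer ry ℤ.* + denom rx
    ; denom = denom rx ℕ.* denom ry
    ; represents = represents-+ {x} {y} {numer rx} {numer ry} {denom rx} {denom ry} (represents rx) (represents ry)
    ; p∤denom = ∤-* (p∤denom rx) (p∤denom ry)
    ; numer≋ = begin
        numer rx ℤ.* + denom ry + numer ry ℤ.* + denom rx
          ≈⟨ +-cong (*-congʳ (+ denom ry) (numer≋ rx)) (*-congʳ (+ denom rx) (numer≋ ry)) ⟩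
        + denom rx ℤ.* c ℤ.* + denom ry + + denom ry ℤ.* e ℤ.* + denom rx
          ≡⟨ ring (+ denom rx) (+ denom ry) c e ⟩
        + denom rx ℤ.* + denom ry ℤ.* (c + e)
          ≡⟨ cong (ℤ._* (c + e)) (ℤP.pos-* (denom rx) (denom ry)) ⟨
        + (denom rx ℕ.* denom ry) ℤ.* (c + e) ∎ }
    where
    open Residue
    open ≋-Reasoning
    ring : ∀ d d' c e → d ℤ.* c ℤ.* d' + d' ℤ.* e ℤ.* d ≡ d ℤ.* d' ℤ.* (c + e)
    ring = solve-∀

  residue-neg : ∀ {x c} → Residue x c → Residue (ℚ.- x) (- c)
  residue-neg {x} {c} rx = record
    { numer = - numer rx ; denom = denom rx
    ; represents = represents-neg {x} {numer rx} {denom rx} (represents rx) ; p∤denom = p∤denom rx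
    ; numer≋ = ≋-trans (neg-cong (numer≋ rx)) (≡⇒≋ (ℤP.neg-distribʳ-* (+ denom rx) c)) }
    where open Residue

  residue-cong : ∀ {x c c'} → c ≋ c' → Residue x c → Residue x c'
  residue-cong c≋c' rx = record
    { numer = numer rx ; denom = denom rx ; represents = represents rx ; p∤denom = p∤denom rx
    ; numer≋ = ≋-trans (numer≋ rx) (*-congˡ (+ denom rx) c≋c') }
    where open Residue

  residue⇒≡[mod] : ∀ {x c} → Residue x c → x ≡ (c ℚ./ 1) [mod p ]
  residue⇒≡[mod] {x} {c} rx = ∣⇒∣ᵤ (∣-cancelˡ (↥ z) (p∤denom rz) p∣d↥z)
    where
    open Residue
    z = x ℚ.- (c ℚ./ 1)
    rz : Residue z (c + - c)
    rz = residue-+ rx (residue-neg (residue-/ c 1 (ℕ∣.>⇒∤ 1<p) (≡⇒≋ (sym (ℤP.*-identityˡ c)))))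
    p∣numer : + p ∣ numer rz
    p∣numer = ∣-along (ring (numer rz) (+ denom rz) c) (p∣difference (numer≋ rz))
      where ring : ∀ a d c → a - d ℤ.* (c + - c) ≡ a
            ring = solve-∀
    p∣d↥z : + p ∣ (+ denom rz ℤ.* ↥ z)
    p∣d↥z = ∣-along (trans (sym (represents rz)) (ℤP.*-comm (↥ z) (+ denom rz)))
                    (∣m⇒∣m*n (↧ z) p∣numer)

module OddPrime (m : ℕ) (p-prime : Prime (suc (2 ℕ.* m))) where
  open Congruence (suc (2 ℕ.* m))
  open PrimeModulus p-prime

  1≤m : 1 ≤ m
  1≤m = positive m 1<p
    where positive : ∀ m → 1 < suc (2 ℕ.* m) → 1 ≤ m
          positive zero    (s≤s ())
          positive (suc _) _ = s≤s z≤n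

  ∤-small : ∀ {k} → suc k ≤ m → ¬ suc (2 ℕ.* m) ∣ℕ suc k
  ∤-small k<m = ℕ∣.>⇒∤ (s≤s (ℕP.≤-trans k<m (ℕP.m≤n*m m 2)))

  ∤-! : ∀ k → k ≤ m → ¬ suc (2 ℕ.* m) ∣ℕ k !
  ∤-! zero    _   = ℕ∣.>⇒∤ 1<p
  ∤-! (suc k) k<m = ∤-* (∤-small k<m) (∤-! k (ℕP.≤-trans (ℕP.n≤1+n k) k<m))

  ∤-4^ : ∀ k → ¬ suc (2 ℕ.* m) ∣ℕ 4 ^ k
  ∤-4^ zero    = ℕ∣.>⇒∤ 1<p
  ∤-4^ (suc k) = ∤-* {4} {4 ^ k} (∤-* {2} {2} ∤-2 ∤-2) (∤-4^ k)
    where ∤-2 = ℕ∣.>⇒∤ (s≤s (ℕP.*-monoʳ-≤ 2 1≤m))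

  -- Both sides change by the same factor
  -- from n to n+1: 2(2n+1)/(n+1) for the left, -4(m-n)/(n+1) for the right,
  -- and 2(2n+1) ≡ -4(m-n) because their difference is 2p.
  central≋ : ∀ n → n ≤ m → + ((n ℕ.+ n) C n) ≋ (- + 4) ℤ.^ n ℤ.* + (m C n)
  central≋ zero    _   = ≡⇒≋ refl
  central≋ (suc n) n<m = cancel (∤-small n<m) (begin
    N ℤ.* + ((suc n ℕ.+ suc n) C suc n)            ≡⟨ cast-* {suc n} {_} {2 ℕ.* suc (n ℕ.+ n)} (central-ratio n) ⟩
    X ℤ.* + ((n ℕ.+ n) C n)                        ≈⟨ *-congˡ X (central≋ n (ℕP.<⇒≤ n<m)) ⟩
    X ℤ.* (F ℤ.* v)                                ≈⟨ *-congʳ (F ℤ.* v) factor≋ ⟩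
    - + 4 ℤ.* (M - N) ℤ.* (F ℤ.* v)                ≡⟨ reassoc (M - N) F v ⟩
    - + 4 ℤ.* F ℤ.* ((M - N) ℤ.* v)                ≡⟨ cong (- + 4 ℤ.* F ℤ.*_) (row-ratioℤ m n) ⟨
    - + 4 ℤ.* F ℤ.* (N ℤ.* v′)                     ≡⟨ reassoc′ F N v′ ⟩
    N ℤ.* ((- + 4) ℤ.^ suc n ℤ.* v′)               ∎)
    where
    open ≋-Reasoning
    X = + (2 ℕ.* suc (n ℕ.+ n))
    F = (- + 4) ℤ.^ n
    v = + (m C n)
    v′ = + (m C suc n)
    M = + suc m
    N = + suc n
    factor≋ : X ≋ - + 4 ℤ.* (M - N)
    factor≋ = ≋-by-multiple (+ 2) (central-factor n m)
    reassoc : ∀ d F v → - + 4 ℤ.* d ℤ.* (F ℤ.* v) ≡ - + 4 ℤ.* F ℤ.* (d ℤ.* v)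
    reassoc = solve-∀
    reassoc′ : ∀ F N v → - + 4 ℤ.* F ℤ.* (N ℤ.* v) ≡ N ℤ.* ((- + 4 ℤ.* F) ℤ.* v)
    reassoc′ = solve-∀

  -- Modulo p = 2m+1 the even factor 2(h+1) equals −(2c+1) when h + c + 1 = m, so the
  -- upper evens (2h+2)…(2m) are, up to the sign (−1)^c, the odd numbers 1·3·…·(2c−1).
  evensFrom≋ : ∀ h c → h ℕ.+ c ≡ m → + evensFrom h c ≋ neg1^ c ℤ.* + odds c
  evensFrom≋ h zero    _   = ≡⇒≋ refl
  evensFrom≋ h (suc c) h+c = begin
    + (2 ℕ.* suc h ℕ.* evensFrom (suc h) c)              ≡⟨ ℤP.pos-* (2 ℕ.* suc h) (evensFrom (suc h) c) ⟩
    + (2 ℕ.* suc h) ℤ.* + evensFrom (suc h) c            ≈⟨ *-cong even≋−odd (evensFrom≋ (suc h) c h+1+c) ⟩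
    - + suc (2 ℕ.* c) ℤ.* (neg1^ c ℤ.* + odds c)         ≡⟨ ring (+ suc (2 ℕ.* c)) (neg1^ c) (+ odds c) ⟩
    neg1^ (suc c) ℤ.* (+ odds c ℤ.* + suc (2 ℕ.* c))     ≡⟨ cong (neg1^ (suc c) ℤ.*_) (ℤP.pos-* (odds c) (suc (2 ℕ.* c))) ⟨
    neg1^ (suc c) ℤ.* + odds (suc c)                     ∎
    where
    open ≋-Reasoning
    h+1+c : suc h ℕ.+ c ≡ m
    h+1+c = trans (sym (ℕP.+-suc h c)) h+c
    even≋−odd : + (2 ℕ.* suc h) ≋ - + suc (2 ℕ.* c)
    even≋−odd = ≋-by-multiple (+ 1) (trans (even+odd h c) (cong (λ k → + 1 ℤ.* + suc (2 ℕ.* k)) h+c))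
    ring : ∀ s σ o → - s ℤ.* (σ ℤ.* o) ≡ (- + 1 ℤ.* σ) ℤ.* (o ℤ.* s)
    ring = solve-∀

  -- Gauss's evaluation of 2^m: when m! = evens h · odds c with h + c = m,
  --   2^m·m! = evens m = evens h · evensFrom h c ≡ (−1)^c · evens h · odds c = (−1)^c · m!.
  two^m≋ : ∀ h c → h ℕ.+ c ≡ m → evens h ℕ.* odds c ≡ m ! → (+ 2) ℤ.^ m ≋ neg1^ c
  two^m≋ h c h+c m! = cancel (∤-! m ℕP.≤-refl) (begin
    + (m !) ℤ.* (+ 2) ℤ.^ m                    ≡⟨ ℤP.*-comm (+ (m !)) ((+ 2) ℤ.^ m) ⟩
    (+ 2) ℤ.^ m ℤ.* + (m !)                    ≡⟨ cong (ℤ._* + (m !)) (pos-^ 2 m) ⟨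
    + (2 ^ m) ℤ.* + (m !)                      ≡⟨ ℤP.pos-* (2 ^ m) (m !) ⟨
    + (2 ^ m ℕ.* m !)                          ≡⟨ cong +_ (evens≡2^h*h! m) ⟨
    + evens m                                  ≡⟨ cong +_ (trans (cong evens (sym h+c)) (evens-split h c)) ⟩
    + (evens h ℕ.* evensFrom h c)              ≡⟨ ℤP.pos-* (evens h) (evensFrom h c) ⟩
    + evens h ℤ.* + evensFrom h c              ≈⟨ *-congˡ (+ evens h) (evensFrom≋ h c h+c) ⟩
    + evens h ℤ.* (neg1^ c ℤ.* + odds c)       ≡⟨ ring (+ evens h) (neg1^ c) (+ odds c) ⟩
    + evens h ℤ.* + odds c ℤ.* neg1^ c         ≡⟨ cong (ℤ._* neg1^ c) (ℤP.pos-* (evens h) (odds c)) ⟨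
    + (evens h ℕ.* odds c) ℤ.* neg1^ c         ≡⟨ cong (λ x → + x ℤ.* neg1^ c) m! ⟩
    + (m !) ℤ.* neg1^ c                        ∎)
    where
    open ≋-Reasoning
    ring : ∀ e σ o → e ℤ.* (σ ℤ.* o) ≡ e ℤ.* o ℤ.* σ
    ring = solve-∀

  -- The k-th summand 4·C(8k,4k)/4^{4k} has residue 4·C(m,4k), since (−4)^{4k} = 4^{4k}.
  term-residue : ∀ k → 4 ℕ.* k ≤ m → Residue (term k) (+ 4 ℤ.* + (m C (4 ℕ.* k)))
  term-residue k 4k≤m = residue-/ (+ (4 ℕ.* ((8 ℕ.* k) C n))) (4 ^ n) {{ℕP.m^n≢0 4 n}} (∤-4^ n) (begin
    + (4 ℕ.* ((8 ℕ.* k) C n))              ≡⟨ ℤP.pos-* 4 ((8 ℕ.* k) C n) ⟩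
    + 4 ℤ.* + ((8 ℕ.* k) C n)              ≡⟨ cong (λ j → + 4 ℤ.* + (j C n)) (double k) ⟩
    + 4 ℤ.* + ((n ℕ.+ n) C n)              ≈⟨ *-congˡ (+ 4) (central≋ n 4k≤m) ⟩
    + 4 ℤ.* ((- + 4) ℤ.^ n ℤ.* + (m C n))  ≡⟨ cong (λ x → + 4 ℤ.* (x ℤ.* + (m C n))) even-sign ⟩
    + 4 ℤ.* ((+ 4) ℤ.^ n ℤ.* + (m C n))    ≡⟨ ring (+ 4) ((+ 4) ℤ.^ n) (+ (m C n)) ⟩
    (+ 4) ℤ.^ n ℤ.* (+ 4 ℤ.* + (m C n))    ≡⟨ cong (ℤ._* (+ 4 ℤ.* + (m C n))) (pos-^ 4 n) ⟨
    + (4 ^ n) ℤ.* (+ 4 ℤ.* + (m C n))      ∎)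
    where
    open ≋-Reasoning
    n = 4 ℕ.* k
    double : ∀ k → 8 ℕ.* k ≡ 4 ℕ.* k ℕ.+ 4 ℕ.* k
    double = ℕSolver.solve-∀
    even-sign : (- + 4) ℤ.^ n ≡ (+ 4) ℤ.^ n
    even-sign = subst (λ e → (- + 4) ℤ.^ e ≡ (+ 4) ℤ.^ e) (sym (ℕP.*-assoc 2 2 k)) (neg^-even (+ 4) (2 ℕ.* k))
    ring : ∀ a x c → a ℤ.* (x ℤ.* c) ≡ x ℤ.* (a ℤ.* c)
    ring = solve-∀

  sumTo-residue : ∀ t → 4 ℕ.* t ≤ m → Residue (sumTo t) (+ 4 ℤ.* + classSum 0 t m)
  sumTo-residue zero    0≤m = term-residue 0 0≤m
  sumTo-residue (suc t) 4t≤m =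
    residue-cong (≡⇒≋ (sym distrib))
      (residue-+ (sumTo-residue t (ℕP.≤-trans (ℕP.*-monoʳ-≤ 4 (ℕP.n≤1+n t)) 4t≤m))
                 (term-residue (suc t) 4t≤m))
    where
    distrib : + 4 ℤ.* + classSum 0 (suc t) m ≡ + 4 ℤ.* + classSum 0 t m + + 4 ℤ.* + (m C (4 ℕ.* suc t))
    distrib = trans (cong (+ 4 ℤ.*_) (ℤP.pos-+ (classSum 0 t m) (m C (4 ℕ.* suc t))))
                    (ℤP.*-distribˡ-+ (+ 4) (+ classSum 0 t m) (+ (m C (4 ℕ.* suc t))))

  -- For m = 4t + s (s ≤ 3) the sum up to t covers all of class 0 of row m; with the
  -- evaluation of 2^m this gives the congruence for the original sum.
  sumTo≡ : ∀ t s {ε target} → m ≡ t ℕ.* 4 ℕ.+ s → s ≤ 3 → (+ 2) ℤ.^ m ≋ ε →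
           ε + + 2 ℤ.* ((- + 4) ℤ.^ t ℤ.* re s) ≡ target → sumTo t ≡ (target ℚ./ 1) [mod suc (2 ℕ.* m) ]
  sumTo≡ t s {ε} {target} m≡ s≤3 two^m ε+2re = residue⇒≡[mod] (residue-cong target≋ (sumTo-residue t 4t≤m))
    where
    4t≤m : 4 ℕ.* t ≤ m
    4t≤m = begin
      4 ℕ.* t         ≡⟨ ℕP.*-comm 4 t ⟩
      t ℕ.* 4         ≤⟨ ℕP.m≤m+n (t ℕ.* 4) s ⟩
      t ℕ.* 4 ℕ.+ s   ≡⟨ m≡ ⟨
      m               ∎
      where open ℕP.≤-Reasoning
    m≤3+4t : m ≤ 3 ℕ.+ 4 ℕ.* t
    m≤3+4t = begin
      m               ≡⟨ m≡ ⟩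
      t ℕ.* 4 ℕ.+ s   ≤⟨ ℕP.+-monoʳ-≤ (t ℕ.* 4) s≤3 ⟩
      t ℕ.* 4 ℕ.+ 3   ≡⟨ swap t ⟩
      3 ℕ.+ 4 ℕ.* t   ∎
      where
      open ℕP.≤-Reasoning
      swap : ∀ t → t ℕ.* 4 ℕ.+ 3 ≡ 3 ℕ.+ 4 ℕ.* t
      swap = ℕSolver.solve-∀
    target≋ : + 4 ℤ.* + classSum 0 t m ≋ target
    target≋ = begin
      + 4 ℤ.* + classSum 0 t m                      ≡⟨ class₀-formula t m 1≤m m≤3+4t ⟩
      (+ 2) ℤ.^ m + + 2 ℤ.* re m                     ≈⟨ +-cong two^m (≡⇒≋ (cong (λ x → + 2 ℤ.* re x) m≡)) ⟩
      ε + + 2 ℤ.* re (t ℕ.* 4 ℕ.+ s)                 ≡⟨ cong (λ x → ε + + 2 ℤ.* x) (re-period t s) ⟩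
      ε + + 2 ℤ.* ((- + 4) ℤ.^ t ℤ.* re s)           ≡⟨ ε+2re ⟩
      target                                        ∎
      where open ≋-Reasoning

[r+t*n]/n≡t : ∀ r t n .{{_ : ℕ.NonZero n}} → r < n → (r ℕ.+ t ℕ.* n) / n ≡ t
[r+t*n]/n≡t r t n r<n =
  trans (+-distrib-/-∣ʳ r (ℕ∣.divides t refl)) (cong₂ ℕ._+_ (m<n⇒m/n≡0 r<n) (m*n/n≡m t n))

exact-/ : ∀ {a} q n .{{_ : ℕ.NonZero n}} → a ≡ q ℕ.* n → a / n ≡ q
exact-/ q n refl = m*n/n≡m q n

Clause₁ Clause₃ Clause₅ Clause₇ : ℕ → Set
Clause₁ p = sumTo ((p ∸ 1) / 8) ≡ ((ℤ.1ℤ ℤ.+ neg1^ ((p ∸ 1) / 8) ℤ.* (+ (2 ^ ((p ℕ.+ 3) / 4)))) ℚ./ 1) [mod p ]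
Clause₃ p = sumTo ((p ∸ 1) / 8) ≡ ((ℤ.- ℤ.1ℤ ℤ.+ neg1^ ((p ∸ 3) / 8) ℤ.* (+ (2 ^ ((p ℕ.+ 1) / 4)))) ℚ./ 1) [mod p ]
Clause₅ p = sumTo ((p ∸ 1) / 8) ≡ ((ℤ.- ℤ.1ℤ) ℚ./ 1) [mod p ]
Clause₇ p = sumTo ((p ∸ 1) / 8) ≡ ((ℤ.1ℤ ℤ.- neg1^ ((p ∸ 7) / 8) ℤ.* (+ (2 ^ ((p ℕ.+ 1) / 4)))) ℚ./ 1) [mod p ]

sumTo-congruence : ∀ t s h c {target} → s ≤ 3 →
                   h ℕ.+ c ≡ t ℕ.* 4 ℕ.+ s → evens h ℕ.* odds c ≡ (t ℕ.* 4 ℕ.+ s) ! →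
                   neg1^ c + + 2 ℤ.* ((- + 4) ℤ.^ t ℤ.* re s) ≡ target →
                   ∀ p → p ≡ suc (2 ℕ.* (t ℕ.* 4 ℕ.+ s)) → Prime p → sumTo t ≡ (target ℚ./ 1) [mod p ]
sumTo-congruence t s h c s≤3 h+c m! value p refl p-prime =
  sumTo≡ t s refl s≤3 (two^m≋ h c h+c m!) value
  where open OddPrime (t ℕ.* 4 ℕ.+ s) p-prime

evaluate : (P : ℕ → ℕ → ℕ → Set) → ∀ {a b e a′ b′ e′} → a ≡ a′ → b ≡ b′ → e ≡ e′ → P a′ b′ e′ → P a b e
evaluate P refl refl refl x = x

-- In each case p = r + 8t, the floors in the statement evaluate to t and to 2t + 1 or 2t + 2,
-- m = (p − 1)/2 = 4t + s, and the sign of 2^m comes from a factorisation m! = evens h · odds c.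
case₁ : ∀ t → Prime (1 ℕ.+ t ℕ.* 8) → Clause₁ (1 ℕ.+ t ℕ.* 8)
case₁ t p-prime =
  evaluate (λ a b e → sumTo a ≡ ((ℤ.1ℤ + neg1^ b ℤ.* + (2 ^ e)) ℚ./ 1) [mod 1 ℕ.+ t ℕ.* 8 ])
    (m*n/n≡m t 8) (m*n/n≡m t 8) (exact-/ (2 ℕ.* t ℕ.+ 1) 4 (arith t))
    (sumTo-congruence t 0 (2 ℕ.* t) (2 ℕ.* t) z≤n (split t) (trans (evens*odds (2 ℕ.* t)) (cong _! (split t)))
      value (1 ℕ.+ t ℕ.* 8) (p≡ t) p-prime)
  where
  arith : ∀ t → 1 ℕ.+ t ℕ.* 8 ℕ.+ 3 ≡ (2 ℕ.* t ℕ.+ 1) ℕ.* 4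
  arith = ℕSolver.solve-∀
  split : ∀ t → 2 ℕ.* t ℕ.+ 2 ℕ.* t ≡ t ℕ.* 4 ℕ.+ 0
  split = ℕSolver.solve-∀
  p≡ : ∀ t → 1 ℕ.+ t ℕ.* 8 ≡ suc (2 ℕ.* (t ℕ.* 4 ℕ.+ 0))
  p≡ = ℕSolver.solve-∀
  value : neg1^ (2 ℕ.* t) + + 2 ℤ.* ((- + 4) ℤ.^ t ℤ.* + 1) ≡ ℤ.1ℤ + neg1^ t ℤ.* + (2 ^ (2 ℕ.* t ℕ.+ 1))
  value = trans (cong₂ _+_ (neg1^-even t) (ring ((- + 4) ℤ.^ t))) (cong (λ x → ℤ.1ℤ + x) (minus4^*two^ t 1))
    where ring : ∀ x → + 2 ℤ.* (x ℤ.* + 1) ≡ x ℤ.* (+ 2) ℤ.^ 1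
          ring = solve-∀

case₃ : ∀ t → Prime (3 ℕ.+ t ℕ.* 8) → Clause₃ (3 ℕ.+ t ℕ.* 8)
case₃ t p-prime =
  evaluate (λ a b e → sumTo a ≡ ((ℤ.- ℤ.1ℤ + neg1^ b ℤ.* + (2 ^ e)) ℚ./ 1) [mod 3 ℕ.+ t ℕ.* 8 ])
    ([r+t*n]/n≡t 2 t 8 (s≤s (s≤s (s≤s z≤n)))) (m*n/n≡m t 8) (exact-/ (2 ℕ.* t ℕ.+ 1) 4 (arith t))
    (sumTo-congruence t 1 (2 ℕ.* t) (suc (2 ℕ.* t)) (s≤s z≤n) (split t)
      (trans (evens*odds-suc (2 ℕ.* t)) (cong _! (trans (sym (ℕP.+-suc (2 ℕ.* t) (2 ℕ.* t))) (split t))))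
      value (3 ℕ.+ t ℕ.* 8) (p≡ t) p-prime)
  where
  arith : ∀ t → 3 ℕ.+ t ℕ.* 8 ℕ.+ 1 ≡ (2 ℕ.* t ℕ.+ 1) ℕ.* 4
  arith = ℕSolver.solve-∀
  split : ∀ t → 2 ℕ.* t ℕ.+ suc (2 ℕ.* t) ≡ t ℕ.* 4 ℕ.+ 1
  split = ℕSolver.solve-∀
  p≡ : ∀ t → 3 ℕ.+ t ℕ.* 8 ≡ suc (2 ℕ.* (t ℕ.* 4 ℕ.+ 1))
  p≡ = ℕSolver.solve-∀
  value : neg1^ (suc (2 ℕ.* t)) + + 2 ℤ.* ((- + 4) ℤ.^ t ℤ.* + 1) ≡ ℤ.- ℤ.1ℤ + neg1^ t ℤ.* + (2 ^ (2 ℕ.* t ℕ.+ 1))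
  value = trans (cong₂ _+_ (cong (- + 1 ℤ.*_) (neg1^-even t)) (ring ((- + 4) ℤ.^ t)))
                (cong (λ x → ℤ.- ℤ.1ℤ + x) (minus4^*two^ t 1))
    where ring : ∀ x → + 2 ℤ.* (x ℤ.* + 1) ≡ x ℤ.* (+ 2) ℤ.^ 1
          ring = solve-∀

case₅ : ∀ t → Prime (5 ℕ.+ t ℕ.* 8) → Clause₅ (5 ℕ.+ t ℕ.* 8)
case₅ t p-prime =
  evaluate (λ a _ _ → sumTo a ≡ ((ℤ.- ℤ.1ℤ) ℚ./ 1) [mod 5 ℕ.+ t ℕ.* 8 ])
    ([r+t*n]/n≡t 4 t 8 (s≤s (s≤s (s≤s (s≤s (s≤s z≤n)))))) (refl {x = 0}) (refl {x = 0})
    (sumTo-congruence t 2 (suc (2 ℕ.* t)) (suc (2 ℕ.* t)) (s≤s (s≤s z≤n)) (split t)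
      (trans (evens*odds (suc (2 ℕ.* t))) (cong _! (split t)))
      value (5 ℕ.+ t ℕ.* 8) (p≡ t) p-prime)
  where
  split : ∀ t → suc (2 ℕ.* t) ℕ.+ suc (2 ℕ.* t) ≡ t ℕ.* 4 ℕ.+ 2
  split = ℕSolver.solve-∀
  p≡ : ∀ t → 5 ℕ.+ t ℕ.* 8 ≡ suc (2 ℕ.* (t ℕ.* 4 ℕ.+ 2))
  p≡ = ℕSolver.solve-∀
  value : neg1^ (suc (2 ℕ.* t)) + + 2 ℤ.* ((- + 4) ℤ.^ t ℤ.* + 0) ≡ ℤ.- ℤ.1ℤ
  value = trans (cong (λ x → - + 1 ℤ.* x + + 2 ℤ.* ((- + 4) ℤ.^ t ℤ.* + 0)) (neg1^-even t)) (ring ((- + 4) ℤ.^ t))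
    where ring : ∀ x → - + 1 ℤ.* + 1 + + 2 ℤ.* (x ℤ.* + 0) ≡ - + 1
          ring = solve-∀

case₇ : ∀ t → Prime (7 ℕ.+ t ℕ.* 8) → Clause₇ (7 ℕ.+ t ℕ.* 8)
case₇ t p-prime =
  evaluate (λ a b e → sumTo a ≡ ((ℤ.1ℤ - neg1^ b ℤ.* + (2 ^ e)) ℚ./ 1) [mod 7 ℕ.+ t ℕ.* 8 ])
    ([r+t*n]/n≡t 6 t 8 (s≤s (s≤s (s≤s (s≤s (s≤s (s≤s (s≤s z≤n)))))))) (m*n/n≡m t 8)
    (exact-/ (2 ℕ.* t ℕ.+ 2) 4 (arith t))
    (sumTo-congruence t 3 h (suc h) (s≤s (s≤s (s≤s z≤n))) (split t)
      (trans (evens*odds-suc h) (cong _! (trans (sym (ℕP.+-suc h h)) (split t))))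
      value (7 ℕ.+ t ℕ.* 8) (p≡ t) p-prime)
  where
  h = suc (2 ℕ.* t)
  arith : ∀ t → 7 ℕ.+ t ℕ.* 8 ℕ.+ 1 ≡ (2 ℕ.* t ℕ.+ 2) ℕ.* 4
  arith = ℕSolver.solve-∀
  split : ∀ t → suc (2 ℕ.* t) ℕ.+ suc (suc (2 ℕ.* t)) ≡ t ℕ.* 4 ℕ.+ 3
  split = ℕSolver.solve-∀
  p≡ : ∀ t → 7 ℕ.+ t ℕ.* 8 ≡ suc (2 ℕ.* (t ℕ.* 4 ℕ.+ 3))
  p≡ = ℕSolver.solve-∀
  value : neg1^ (suc h) + + 2 ℤ.* ((- + 4) ℤ.^ t ℤ.* - + 2) ≡ ℤ.1ℤ - neg1^ t ℤ.* + (2 ^ (2 ℕ.* t ℕ.+ 2))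
  value = trans (cong₂ _+_ (cong (λ x → - + 1 ℤ.* (- + 1 ℤ.* x)) (neg1^-even t)) (ring ((- + 4) ℤ.^ t)))
                (cong (λ x → ℤ.1ℤ - x) (minus4^*two^ t 2))
    where ring : ∀ x → + 2 ℤ.* (x ℤ.* - + 2) ≡ - (x ℤ.* (+ 2) ℤ.^ 2)
          ring = solve-∀

theorem4p2 : (p : ℕ) → Prime p → p ≢ 2 →
    ((p % 8 ≡ 1 → sumTo ((p ∸ 1) / 8) ≡ ((ℤ.1ℤ ℤ.+ neg1^ ((p ∸ 1) / 8) ℤ.* (+ (2 ^ ((p ℕ.+ 3) / 4)))) ℚ./ 1) [mod p ])
    × (p % 8 ≡ 3 → sumTo ((p ∸ 1) / 8) ≡ ((ℤ.- ℤ.1ℤ ℤ.+ neg1^ ((p ∸ 3) / 8) ℤ.* (+ (2 ^ ((p ℕ.+ 1) / 4)))) ℚ./ 1) [mod p ])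
    × (p % 8 ≡ 5 → sumTo ((p ∸ 1) / 8) ≡ ((ℤ.- ℤ.1ℤ) ℚ./ 1) [mod p ])
    × (p % 8 ≡ 7 → sumTo ((p ∸ 1) / 8) ≡ ((ℤ.1ℤ ℤ.- neg1^ ((p ∸ 7) / 8) ℤ.* (+ (2 ^ ((p ℕ.+ 1) / 4)))) ℚ./ 1) [mod p ]))
theorem4p2 p p-prime _ =
  by-residue Clause₁ case₁ , by-residue Clause₃ case₃ , by-residue Clause₅ case₅ , by-residue Clause₇ case₇
  where
  -- p ≡ r (mod 8) means p = r + 8⌊p/8⌋, to which the case for r applies.
  by-residue : ∀ {r} (Clause : ℕ → Set) → (∀ t → Prime (r ℕ.+ t ℕ.* 8) → Clause (r ℕ.+ t ℕ.* 8)) →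
               p % 8 ≡ r → Clause p
  by-residue {r} Clause case p%8≡r = subst Clause (sym p≡) (case (p / 8) (subst Prime p≡ p-prime))
    where
    p≡ : p ≡ r ℕ.+ (p / 8) ℕ.* 8
    p≡ = trans (m≡m%n+[m/n]*n p 8) (cong (ℕ._+ (p / 8) ℕ.* 8) p%8≡r)
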